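{- Let $V,U\in\Sigma_\$^+$ and $z=\max\{|V|,|U|\}$. Then $V\prec_\omega U$ if and only if $\mathrm{PD}(V^\omega[..3z])<\mathrm{PD}(U^\omega[..3z])$.
   Context: $\Sigma=[0..\sigma]$ is an integer alphabet, $\$\notin\Sigma$ is a symbol smaller than every integer, $\Sigma_\$=\Sigma\cup\{\$\}$, $\infty$ is a symbol larger than every integer. Strings are 1-indexed; $X[..i]=X[1..i]$, $X[i..]=X[i..|X|]$; $X^\omega$ is the infinite concatenation of $X$. Every nonempty $X$ is $Y^k$ for a unique primitive $Y=:\mathrm{root}(X)$. $\mathrm{lcp}(U,V)$ = longest common prefix length; $U<V$ iff $U$ is a proper prefix of $V$ or $U[\ell+1]<V[\ell+1]$ with $\ell=\mathrm{lcp}(U,V)$. $\mathrm{PD}(V)[i]=\infty$ if $V[i]\neq\$$ and $V[i]<V[j]$ for all $j<i$; $=\$$ if $V[i]=\$$; otherwise $i-\max\{j<i:V[j]\le V[i]\}$. $\mathrm{RPD}(V)=\mathrm{PD}(V^2)[|V|+1..]$. $V\preceq_\omega U$ iff there is a natural $i$ with $\mathrm{PD}(V^\omega[..i])<\mathrm{PD}(U^\omega[..i])$ or $\mathrm{root}(\mathrm{RPD}(V))=\mathrm{root}(\mathrm{RPD}(U))$; $V=_\omega U$ iff both $V\preceq_\omega U$ and $U\preceq_\omega V$; $V\prec_\omega U$ iff $V\preceq_\omega U$ and not $V=_\omega U$. -}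

module Defs where

open import Data.Nat using (ℕ; zero; suc; _≤_; _<_; _≤?_; _*_; _⊔_)
open import Data.List using (List; []; _∷_; _++_; take; drop; concat; replicate; length)
open import Data.List.Relation.Binary.Lex.Core using (Lex-<)
open import Data.Product using (Σ; ∃; _×_; _,_)
open import Data.Sum using (_⊎_)
open import Relation.Binary.PropositionalEquality using (_≡_; _≢_)
open import Relation.Nullary using (¬_; yes; no)

-- Σ_$ : the sentinel $ (smaller than every integer) or an integer letter.
data Sym : Set where
  $   : Sym
  chr : ℕ → Sym

data _≤ₛ_ : Sym → Sym → Set where
  $≤    : ∀ {x} → $ ≤ₛ x
  chr≤  : ∀ {a b} → a ≤ b → chr a ≤ₛ chr b

data PDSym : Set where
  pd$  : PDSym
  num  : ℕ → PDSym
  ∞    : PDSym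

data _<ₚ_ : PDSym → PDSym → Set where
  $<num : ∀ {n} → pd$ <ₚ num n
  $<∞   : pd$ <ₚ ∞
  num<num : ∀ {m n} → m < n → num m <ₚ num n
  num<∞ : ∀ {n} → num n <ₚ ∞

_<PD_ : List PDSym → List PDSym → Set
_<PD_ = Lex-< _≡_ _<ₚ_

-- distance (1-based) to the nearest earlier letter ≤ the integer a,
-- the earlier letters given nearest-first; ∞ if none exists
nearest : ℕ → ℕ → List Sym → PDSym
nearest a d [] = ∞
nearest a d ($ ∷ ys) = num d
nearest a d (chr b ∷ ys) with b ≤? a
... | yes _ = num d
... | no  _ = nearest a (suc d) ys

pdAt : List Sym → Sym → PDSym
pdAt prev $ = pd$
pdAt prev (chr a) = nearest a 1 prev

-- PD computed left to right; acc holds the already read prefix reversed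
pdGo : List Sym → List Sym → List PDSym
pdGo acc [] = []
pdGo acc (x ∷ xs) = pdAt acc x ∷ pdGo (x ∷ acc) xs

PD : List Sym → List PDSym
PD = pdGo []

_^_ : {A : Set} → List A → ℕ → List A
X ^ k = concat (replicate k X)

-- V^ω[..i]  (for nonempty V, i copies suffice)
ωpre : List Sym → ℕ → List Sym
ωpre V i = take i (V ^ i)

RPD : List Sym → List PDSym
RPD V = drop (length V) (PD (V ++ V))

Primitive : {A : Set} → List A → Set
Primitive Y = (Y ≢ []) × (∀ Z k → Y ≡ Z ^ k → k ≡ 1)

IsRoot : {A : Set} → List A → List A → Set
IsRoot Y X = Primitive Y × ∃ λ k → X ≡ Y ^ k

SameRoot : {A : Set} → List A → List A → Set
SameRoot {A} X X' = Σ (List A) λ Y → IsRoot Y X × IsRoot Y X'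

_⪯ω_ : List Sym → List Sym → Set
V ⪯ω U = (∃ λ i → PD (ωpre V i) <PD PD (ωpre U i)) ⊎ SameRoot (RPD V) (RPD U)

_=ω_ : List Sym → List Sym → Set
V =ω U = (V ⪯ω U) × (U ⪯ω V)

_≺ω_ : List Sym → List Sym → Set
V ≺ω U = (V ⪯ω U) × ¬ (V =ω U)

{-# OPTIONS --safe #-}
-- Let pd_V i be the PD value at position i of V^ω and p = |V|.  The letter at
-- position p + i equals the one at i, which stops the search for a smaller or equal
-- letter within distance p; so from position p on, pd_V is p-periodic, and pd_V j
-- is pd_V (p + j) with all distances larger than j replaced by ∞.  RPD V is one period
-- pd_V[p .. 2p).  If RPD V and RPD U share a root Y, both pd_V and pd_U are tails
-- of Y^ω, and forgetting large distances at a common position gives pd_V = pd_U;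
-- hence V =ω U whenever their RPDs share a root, and otherwise V ≺ω U means that
-- pd_V is lexicographically smaller than pd_U.  Finally, in the style of Fine and
-- Wilf, sequences that are periodic from p resp. q on with p, q ≤ z and agree
-- below 3z agree everywhere: every i ≥ 3z is p + q + b with b ≥ p, q, and its
-- value is reached by period steps from smaller positions.  So the first
-- difference between pd_V and pd_U, if any, lies below 3z.
module Submission where

open import Defs
open import Data.Nat using (ℕ; _*_; _⊔_)
open import Data.List using (List; []; length)
open import Relation.Binary.PropositionalEquality using (_≢_)
open import Function.Bundles using (_⇔_)

open import Data.Empty using (⊥-elim)
open import Data.Fin as Fin using (toℕ)
open import Data.Fin.Properties using (toℕ-injective; toℕ-fromℕ<; toℕ<n; fromℕ<-cong)
open import Data.List
  using (_∷_; _++_; _∷ʳ_; _ʳ++_; reverse; take; drop; lookup; applyUpTo; applyDownFrom)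
open import Data.List.Properties
  using ( ∷-injectiveˡ; ∷-injectiveʳ; applyUpTo-∷ʳ; reverse-applyUpTo
        ; length-applyUpTo; length-applyDownFrom)
open import Data.List.Relation.Binary.Lex.Core using (Lex-<; base; this; next)
open import Data.List.Relation.Unary.Any using (Any; here; there)
open import Data.List.Relation.Unary.Any.Properties using (applyDownFrom⁺)
open import Data.Nat
  using (zero; suc; _+_; _∸_; _≤_; _<_; _≤?_; _<?_; z≤n; s≤s; z<s; s<s; NonZero; >-nonZero⁻¹)
open import Data.Nat.DivMod using (_%_; _/_; _mod_; m≡m%n+[m/n]*n; m%n<n; [m+n]%n≡m%n; m<n⇒m%n≡m)
open import Data.Nat.Induction using (<-rec)
open import Data.Nat.Properties
open import Algebra.Properties.CommutativeSemigroup +-commutativeSemigroup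
  using () renaming (x∙yz≈y∙xz to m+[n+o]≡n+[m+o])
open import Data.Product using (∃; _×_; _,_)
open import Data.Sum using (inj₁; inj₂)
open import Function using (_∘_)
open import Function.Bundles using (mk⇔)
open import Level using (Level)
open import Relation.Binary.Core using (Rel)
open import Relation.Binary.Definitions using (Asymmetric; tri<; tri≈; tri>)
open import Relation.Binary.PropositionalEquality
  using (_≡_; refl; sym; trans; cong; cong₂; subst; subst₂; _≗_; module ≡-Reasoning)
open import Relation.Nullary using (¬_; yes; no)

open ≡-Reasoning

private variable
  ℓ : Level
  A : Set
  f g : ℕ → A

applyUpTo-cong : f ≗ g → ∀ n → applyUpTo f n ≡ applyUpTo g n
applyUpTo-cong f≗g zero    = refl
applyUpTo-cong f≗g (suc n) = cong₂ _∷_ (f≗g 0) (applyUpTo-cong (f≗g ∘ suc) n)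

applyDownFrom-cong : f ≗ g → ∀ n → applyDownFrom f n ≡ applyDownFrom g n
applyDownFrom-cong f≗g zero    = refl
applyDownFrom-cong f≗g (suc n) = cong₂ _∷_ (f≗g n) (applyDownFrom-cong f≗g n)

applyUpTo-++ : ∀ (f : ℕ → A) m n → applyUpTo f (m + n) ≡ applyUpTo f m ++ applyUpTo (f ∘ (m +_)) n
applyUpTo-++ f zero    n = refl
applyUpTo-++ f (suc m) n = cong (f 0 ∷_) (applyUpTo-++ (f ∘ suc) m n)

applyDownFrom-++ : ∀ (f : ℕ → A) m n →
                   applyDownFrom f (m + n) ≡ applyDownFrom (λ i → f (i + n)) m ++ applyDownFrom f n
applyDownFrom-++ f zero    n = refl
applyDownFrom-++ f (suc m) n = cong (f (m + n) ∷_) (applyDownFrom-++ f m n)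

take-applyUpTo : ∀ (f : ℕ → A) {m n} → m ≤ n → take m (applyUpTo f n) ≡ applyUpTo f m
take-applyUpTo f z≤n       = refl
take-applyUpTo f (s≤s m≤n) = cong (f 0 ∷_) (take-applyUpTo (f ∘ suc) m≤n)

drop-applyUpTo : ∀ (f : ℕ → A) m n → drop m (applyUpTo f (m + n)) ≡ applyUpTo (f ∘ (m +_)) n
drop-applyUpTo f zero    n = refl
drop-applyUpTo f (suc m) n = drop-applyUpTo (f ∘ suc) m n

applyUpTo-≡⇒≡ : ∀ {n} → applyUpTo f n ≡ applyUpTo g n → ∀ {i} → i < n → f i ≡ g i
applyUpTo-≡⇒≡ {n = suc n} eq {zero}  _ = ∷-injectiveˡ eq
applyUpTo-≡⇒≡ {f = f} {g = g} {suc n} eq {suc i} (s<s i<n) =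
  applyUpTo-≡⇒≡ {f = f ∘ suc} {g = g ∘ suc} (∷-injectiveʳ eq) i<n

applyUpTo-lookup : ∀ (xs : List A) → (∀ i → f (toℕ i) ≡ lookup xs i) → applyUpTo f (length xs) ≡ xs
applyUpTo-lookup []       _    = refl
applyUpTo-lookup (x ∷ xs) f≡xs = cong₂ _∷_ (f≡xs Fin.zero) (applyUpTo-lookup xs (f≡xs ∘ Fin.suc))

length-nonZero : {xs : List A} → xs ≢ [] → NonZero (length xs)
length-nonZero {xs = []}    xs≢[] = ⊥-elim (xs≢[] refl)
length-nonZero {xs = _ ∷ _} _     = _

-- Periodic sequences

Periodic : ℕ → (ℕ → A) → Set
Periodic p f = ∀ i → f (p + i) ≡ f i

periodic-* : ∀ {p} → Periodic p f → ∀ m → Periodic (m * p) f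
periodic-*                 f-periodic zero    i = refl
periodic-* {f = f} {p = p} f-periodic (suc m) i = begin
  f (p + m * p + i)   ≡⟨ cong f (+-assoc p (m * p) i) ⟩
  f (p + (m * p + i)) ≡⟨ f-periodic (m * p + i) ⟩
  f (m * p + i)       ≡⟨ periodic-* f-periodic m i ⟩
  f i                 ∎

periodic-≗ : ∀ {p} .{{_ : NonZero p}} → Periodic p f → Periodic p g →
             (∀ {i} → i < p → f i ≡ g i) → f ≗ g
periodic-≗ {f = f} {g = g} {p = p} f-periodic g-periodic agree i = begin
  f i                   ≡⟨ cong f (divMod i) ⟩
  f (i / p * p + i % p) ≡⟨ periodic-* f-periodic (i / p) (i % p) ⟩
  f (i % p)             ≡⟨ agree (m%n<n i p) ⟩
  g (i % p)             ≡⟨ periodic-* g-periodic (i / p) (i % p) ⟨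
  g (i / p * p + i % p) ≡⟨ cong g (divMod i) ⟨
  g i                   ∎
  where
  divMod : ∀ i → i ≡ i / p * p + i % p
  divMod i = trans (m≡m%n+[m/n]*n i p) (+-comm (i % p) (i / p * p))

periodic-from : ∀ {p} → Periodic p (f ∘ (p +_)) → ∀ {i} → p ≤ i → f (p + i) ≡ f i
periodic-from f-periodic p≤i with m≤n⇒∃[o]m+o≡n p≤i
... | k , refl = f-periodic k

module _ {p q z : ℕ} .{{_ : NonZero p}} .{{_ : NonZero q}} (p≤z : p ≤ z) (q≤z : q ≤ z) where

  eventually-periodic-≗ : Periodic p (f ∘ (p +_)) → Periodic q (g ∘ (q +_)) →
                          (∀ {i} → i < 3 * z → f i ≡ g i) → f ≗ g
  eventually-periodic-≗ {f = f} {g = g} f-periodic g-periodic agree = <-rec (λ i → f i ≡ g i) step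
    where
    split : ∀ {i} → 3 * z ≤ i → ∃ λ b → p ≤ b × q ≤ b × p + (q + b) ≡ i
    split {i} 3z≤i =
      b , ≤-trans p≤z z≤b , ≤-trans q≤z z≤b , trans (sym (+-assoc p q b)) (m+[n∸m]≡n p+q≤i)
      where
      b : ℕ
      b = i ∸ (p + q)
      z+[p+q]≤i : z + (p + q) ≤ i
      z+[p+q]≤i = ≤-trans (+-monoʳ-≤ z (+-mono-≤ p≤z q≤z))
                          (≤-trans (≤-reflexive (cong (λ t → z + (z + t)) (sym (+-identityʳ z)))) 3z≤i)
      z≤b : z ≤ b
      z≤b = m+n≤o⇒m≤o∸n z z+[p+q]≤i
      p+q≤i : p + q ≤ i
      p+q≤i = m+n≤o⇒n≤o z z+[p+q]≤i

    step : ∀ i → (∀ {j} → j < i → f j ≡ g j) → f i ≡ g i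
    step i rec with i <? 3 * z
    ... | yes i<3z = agree i<3z
    ... | no  i≮3z with split (≮⇒≥ i≮3z)
    ...   | b , p≤b , q≤b , refl = begin
      f (p + (q + b)) ≡⟨ periodic-from {f = f} f-periodic (≤-trans p≤b (m≤n+m b q)) ⟩
      f (q + b)       ≡⟨ rec (m<n+m (q + b) (>-nonZero⁻¹ p)) ⟩
      g (q + b)       ≡⟨ periodic-from {f = g} g-periodic q≤b ⟩
      g b             ≡⟨ rec (<-≤-trans (m<n+m b (>-nonZero⁻¹ q)) (m≤n+m (q + b) p)) ⟨
      f b             ≡⟨ periodic-from {f = f} f-periodic p≤b ⟨
      f (p + b)       ≡⟨ rec (+-monoʳ-< p (m<n+m b (>-nonZero⁻¹ q))) ⟩
      g (p + b)       ≡⟨ periodic-from {f = g} g-periodic (≤-trans q≤b (m≤n+m b p)) ⟨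
      g (q + (p + b)) ≡⟨ cong g (m+[n+o]≡n+[m+o] q p b) ⟩
      g (p + (q + b)) ∎

-- The periodic sequence xs^ω

cycle : (xs : List A) .{{_ : NonZero (length xs)}} → ℕ → A
cycle xs i = lookup xs (i mod length xs)

module _ (xs : List A) .{{_ : NonZero (length xs)}} where

  cycle-periodic : Periodic (length xs) (cycle xs)
  cycle-periodic i = cong (lookup xs) (fromℕ<-cong _ _ [p+i]%p≡i%p _ _)
    where
    [p+i]%p≡i%p : (length xs + i) % length xs ≡ i % length xs
    [p+i]%p≡i%p = trans (cong (_% length xs) (+-comm (length xs) i)) ([m+n]%n≡m%n i (length xs))

  applyUpTo-cycle : applyUpTo (cycle xs) (length xs) ≡ xs
  applyUpTo-cycle = applyUpTo-lookup xs λ i →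
    cong (lookup xs) (toℕ-injective (trans (toℕ-fromℕ< _) (m<n⇒m%n≡m (toℕ<n i))))

  ++-cycle : ∀ n → xs ++ applyUpTo (cycle xs) n ≡ applyUpTo (cycle xs) (length xs + n)
  ++-cycle n = begin
    xs ++ applyUpTo (cycle xs) n
      ≡⟨ cong₂ _++_ applyUpTo-cycle (applyUpTo-cong cycle-periodic n) ⟨
    applyUpTo (cycle xs) (length xs) ++ applyUpTo (cycle xs ∘ (length xs +_)) n
      ≡⟨ applyUpTo-++ (cycle xs) (length xs) n ⟨
    applyUpTo (cycle xs) (length xs + n) ∎

  ^-cycle : ∀ k → xs ^ k ≡ applyUpTo (cycle xs) (k * length xs)
  ^-cycle zero    = refl
  ^-cycle (suc k) = trans (cong (xs ++_) (^-cycle k)) (++-cycle (k * length xs))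

ωpre-cycle : (V : List Sym) .{{_ : NonZero (length V)}} → ∀ n → ωpre V n ≡ applyUpTo (cycle V) n
ωpre-cycle V n = trans (cong (take n) (^-cycle V n)) (take-applyUpTo (cycle V) (m≤m*n n (length V)))

-- Lexicographic order of prefixes and first differences

record FirstDifference (_≺_ : Rel A ℓ) (f g : ℕ → A) (j : ℕ) : Set ℓ where
  constructor firstDifference
  field
    agree  : ∀ {i} → i < j → f i ≡ g i
    differ : f j ≺ g j

module _ {_≺_ : Rel A ℓ} where

  Lex-<⇒FirstDifference : ∀ n → Lex-< _≡_ _≺_ (applyUpTo f n) (applyUpTo g n) →
                          ∃ λ j → j < n × FirstDifference _≺_ f g j
  Lex-<⇒FirstDifference zero    (base ())
  Lex-<⇒FirstDifference (suc n) (this f0≺g0) = 0 , z<s , firstDifference (λ ()) f0≺g0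
  Lex-<⇒FirstDifference {f = f} {g = g} (suc n) (next f0≡g0 rest)
    with Lex-<⇒FirstDifference {f = f ∘ suc} {g = g ∘ suc} n rest
  ... | j , j<n , firstDifference agree fj≺gj = suc j , s<s j<n , firstDifference agree′ fj≺gj
    where
    agree′ : ∀ {i} → i < suc j → f i ≡ g i
    agree′ {zero}  _         = f0≡g0
    agree′ {suc i} (s<s i<j) = agree i<j

  FirstDifference⇒Lex-< : ∀ {j n} → j < n → FirstDifference _≺_ f g j →
                          Lex-< _≡_ _≺_ (applyUpTo f n) (applyUpTo g n)
  FirstDifference⇒Lex-< {j = zero}  z<s       (firstDifference _ f0≺g0)     = this f0≺g0
  FirstDifference⇒Lex-< {j = suc j} (s<s j<n) (firstDifference agree fj≺gj) =
    next (agree z<s) (FirstDifference⇒Lex-< j<n (firstDifference (λ i<j → agree (s<s i<j)) fj≺gj))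

  module _ (≺-asym : Asymmetric _≺_) where

    FirstDifference-irrefl : ∀ {j} → f ≗ g → ¬ FirstDifference _≺_ f g j
    FirstDifference-irrefl {j = j} f≗g (firstDifference _ fj≺gj) =
      ≺-asym fj≺gj (subst₂ _≺_ (f≗g j) (sym (f≗g j)) fj≺gj)

    FirstDifference-asym : ∀ {j k} → FirstDifference _≺_ f g j → ¬ FirstDifference _≺_ g f k
    FirstDifference-asym {j = j} {k} (firstDifference agree fj≺gj) (firstDifference agree′ gk≺fk)
      with <-cmp j k
    ... | tri< j<k _ _  = ≺-asym fj≺gj (subst₂ _≺_ (sym (agree′ j<k)) (agree′ j<k) fj≺gj)
    ... | tri≈ _ refl _ = ≺-asym fj≺gj gk≺fk
    ... | tri> _ _ k<j  = ≺-asym gk≺fk (subst₂ _≺_ (sym (agree k<j)) (agree k<j) gk≺fk)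

<ₚ-asym : Asymmetric _<ₚ_
<ₚ-asym (num<num m<n) (num<num n<m) = <-asym m<n n<m

-- PD values of a sequence

pdOf : (ℕ → Sym) → ℕ → PDSym
pdOf s i = pdAt (applyDownFrom s i) (s i)

pdGo-∷ʳ : ∀ acc xs x → pdGo acc (xs ∷ʳ x) ≡ pdGo acc xs ∷ʳ pdAt (xs ʳ++ acc) x
pdGo-∷ʳ acc []       x = refl
pdGo-∷ʳ acc (y ∷ xs) x = cong (pdAt acc y ∷_) (pdGo-∷ʳ (y ∷ acc) xs x)

PD-applyUpTo : ∀ s n → PD (applyUpTo s n) ≡ applyUpTo (pdOf s) n
PD-applyUpTo s zero    = refl
PD-applyUpTo s (suc n) = begin
  PD (applyUpTo s (suc n))
    ≡⟨ cong PD (applyUpTo-∷ʳ s n) ⟨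
  PD (applyUpTo s n ∷ʳ s n)
    ≡⟨ pdGo-∷ʳ [] (applyUpTo s n) (s n) ⟩
  PD (applyUpTo s n) ∷ʳ pdAt (reverse (applyUpTo s n)) (s n)
    ≡⟨ cong₂ (λ pds prev → pds ∷ʳ pdAt prev (s n)) (PD-applyUpTo s n) (reverse-applyUpTo s n) ⟩
  applyUpTo (pdOf s) n ∷ʳ pdOf s n
    ≡⟨ applyUpTo-∷ʳ (pdOf s) n ⟩
  applyUpTo (pdOf s) (suc n) ∎

≤ₛ-refl : ∀ {x} → x ≤ₛ x
≤ₛ-refl {$}     = $≤
≤ₛ-refl {chr a} = chr≤ ≤-refl

nearest-++ : ∀ a d {W} R → Any (_≤ₛ chr a) W → nearest a d (W ++ R) ≡ nearest a d W
nearest-++ a d {$ ∷ W}     R _ = refl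
nearest-++ a d {chr b ∷ W} R stop with b ≤? a | stop
... | yes _   | _               = refl
... | no  b≰a | here (chr≤ b≤a) = ⊥-elim (b≰a b≤a)
... | no  _   | there stop′     = nearest-++ a (suc d) R stop′

pdAt-++ : ∀ {W} R x → Any (_≤ₛ x) W → pdAt (W ++ R) x ≡ pdAt W x
pdAt-++ R $       _    = refl
pdAt-++ R (chr a) stop = nearest-++ a 1 R stop

cap : ℕ → PDSym → PDSym
cap c pd$     = pd$
cap c ∞       = ∞
cap c (num e) with e ≤? c
... | yes _ = num e
... | no  _ = ∞

cap-≤ : ∀ {c e} → e ≤ c → cap c (num e) ≡ num e
cap-≤ {c} {e} e≤c with e ≤? c
... | yes _   = refl
... | no  e≰c = ⊥-elim (e≰c e≤c)

cap-> : ∀ {c e} → c < e → cap c (num e) ≡ ∞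
cap-> {c} {e} c<e with e ≤? c
... | yes e≤c = ⊥-elim (<⇒≱ c<e e≤c)
... | no  _   = refl

nearest-beyond : ∀ a {c d} R → c ≤ d → cap c (nearest a (suc d) R) ≡ ∞
nearest-beyond a []          c≤d = refl
nearest-beyond a ($ ∷ R)     c≤d = cap-> (s≤s c≤d)
nearest-beyond a (chr b ∷ R) c≤d with b ≤? a
... | yes _ = cap-> (s≤s c≤d)
... | no  _ = nearest-beyond a R (m≤n⇒m≤1+n c≤d)

nearest-cap : ∀ a d L R → cap (d + length L) (nearest a (suc d) (L ++ R)) ≡ nearest a (suc d) L
nearest-cap a d []          R = nearest-beyond a R (≤-reflexive (+-identityʳ d))
nearest-cap a d ($ ∷ L)     R = cap-≤ (m<m+n d z<s)
nearest-cap a d (chr b ∷ L) R with b ≤? a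
... | yes _ = cap-≤ (m<m+n d z<s)
... | no  _ = trans (cong (λ c → cap c (nearest a (2 + d) (L ++ R))) (+-suc d (length L)))
                    (nearest-cap a (suc d) L R)

pdAt-cap : ∀ L R x → cap (length L) (pdAt (L ++ R) x) ≡ pdAt L x
pdAt-cap L R $       = refl
pdAt-cap L R (chr a) = nearest-cap a 0 L R

-- PD values of periodic sequences

module _ {s : ℕ → Sym} {p : ℕ} (s-periodic : Periodic p s) where

  pdOf-cap : ∀ j → pdOf s j ≡ cap j (pdOf s (p + j))
  pdOf-cap j = begin
    pdAt (applyDownFrom s j) (s j)
      ≡⟨ pdAt-cap (applyDownFrom s j) (applyDownFrom s p) (s j) ⟨
    cap (length (applyDownFrom s j)) (pdAt (applyDownFrom s j ++ applyDownFrom s p) (s j))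
      ≡⟨ cong₂ (λ c prev → cap c (pdAt prev (s j))) (length-applyDownFrom s j) (sym recent) ⟩
    cap j (pdAt (applyDownFrom s (p + j)) (s j))
      ≡⟨ cong (cap j ∘ pdAt (applyDownFrom s (p + j))) (s-periodic j) ⟨
    cap j (pdOf s (p + j)) ∎
    where
    recent : applyDownFrom s (p + j) ≡ applyDownFrom s j ++ applyDownFrom s p
    recent = begin
      applyDownFrom s (p + j)
        ≡⟨ cong (applyDownFrom s) (+-comm p j) ⟩
      applyDownFrom s (j + p)
        ≡⟨ applyDownFrom-++ s j p ⟩
      applyDownFrom (λ i → s (i + p)) j ++ applyDownFrom s p
        ≡⟨ cong (_++ applyDownFrom s p) (applyDownFrom-cong shift j) ⟩
      applyDownFrom s j ++ applyDownFrom s p ∎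
      where
      shift : ∀ i → s (i + p) ≡ s i
      shift i = trans (cong s (+-comm i p)) (s-periodic i)

  module _ .{{_ : NonZero p}} where

    pdOf-window : ∀ j → pdOf s (p + j) ≡ pdAt (applyDownFrom (λ i → s (i + j)) p) (s j)
    pdOf-window j = begin
      pdAt (applyDownFrom s (p + j)) (s (p + j))
        ≡⟨ cong₂ pdAt (applyDownFrom-++ s p j) (s-periodic j) ⟩
      pdAt (applyDownFrom (λ i → s (i + j)) p ++ applyDownFrom s j) (s j)
        ≡⟨ pdAt-++ (applyDownFrom s j) (s j) (applyDownFrom⁺ _ ≤ₛ-refl (>-nonZero⁻¹ p)) ⟩
      pdAt (applyDownFrom (λ i → s (i + j)) p) (s j) ∎

    pdOf-periodic : Periodic p (pdOf s ∘ (p +_))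
    pdOf-periodic j = begin
      pdOf s (p + (p + j))
        ≡⟨ pdOf-window (p + j) ⟩
      pdAt (applyDownFrom (λ i → s (i + (p + j))) p) (s (p + j))
        ≡⟨ cong₂ pdAt (applyDownFrom-cong shift p) (s-periodic j) ⟩
      pdAt (applyDownFrom (λ i → s (i + j)) p) (s j)
        ≡⟨ pdOf-window j ⟨
      pdOf s (p + j) ∎
      where
      shift : ∀ i → s (i + (p + j)) ≡ s (i + j)
      shift i = trans (cong s (m+[n+o]≡n+[m+o] i p j)) (s-periodic (i + j))

pdω : (V : List Sym) .{{_ : NonZero (length V)}} → ℕ → PDSym
pdω V = pdOf (cycle V)

module _ (V : List Sym) .{{_ : NonZero (length V)}} where

  private
    p : ℕ
    p = length V

  PD-ωpre : ∀ n → PD (ωpre V n) ≡ applyUpTo (pdω V) n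
  PD-ωpre n = trans (cong PD (ωpre-cycle V n)) (PD-applyUpTo (cycle V) n)

  pdω-periodic : Periodic p (pdω V ∘ (p +_))
  pdω-periodic = pdOf-periodic (cycle-periodic V)

  pdω-cap : ∀ m j → pdω V j ≡ cap j (pdω V (p + (m * p + j)))
  pdω-cap m j = trans (pdOf-cap (cycle-periodic V) j) (cong (cap j) (sym (periodic-* pdω-periodic m j)))

  RPD-pdω : RPD V ≡ applyUpTo (pdω V ∘ (p +_)) p
  RPD-pdω = begin
    drop p (PD (V ++ V))                      ≡⟨ cong (drop p ∘ PD ∘ (V ++_)) (applyUpTo-cycle V) ⟨
    drop p (PD (V ++ applyUpTo (cycle V) p))  ≡⟨ cong (drop p ∘ PD) (++-cycle V p) ⟩
    drop p (PD (applyUpTo (cycle V) (p + p))) ≡⟨ cong (drop p) (PD-applyUpTo (cycle V) (p + p)) ⟩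
    drop p (applyUpTo (pdω V) (p + p))        ≡⟨ drop-applyUpTo (pdω V) p p ⟩
    applyUpTo (pdω V ∘ (p +_)) p              ∎

  RPD≡^⇒pdω≗cycle : (Y : List PDSym) .{{_ : NonZero (length Y)}} → ∀ l → RPD V ≡ Y ^ l →
                     ∀ i → pdω V (p + i) ≡ cycle Y i
  RPD≡^⇒pdω≗cycle Y l RPD≡Y^l = periodic-≗ pdω-periodic Y-periodic (applyUpTo-≡⇒≡ periods)
    where
    periods′ : applyUpTo (pdω V ∘ (p +_)) p ≡ applyUpTo (cycle Y) (l * length Y)
    periods′ = trans (sym RPD-pdω) (trans RPD≡Y^l (^-cycle Y l))
    p≡l*|Y| : p ≡ l * length Y
    p≡l*|Y| = trans (sym (length-applyUpTo _ p)) (trans (cong length periods′) (length-applyUpTo _ _))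
    periods : applyUpTo (pdω V ∘ (p +_)) p ≡ applyUpTo (cycle Y) p
    periods = trans periods′ (cong (applyUpTo (cycle Y)) (sym p≡l*|Y|))
    Y-periodic : Periodic p (cycle Y)
    Y-periodic = subst (λ r → Periodic r (cycle Y)) (sym p≡l*|Y|) (periodic-* (cycle-periodic Y) l)

SameRoot-sym : {X X′ : List A} → SameRoot X X′ → SameRoot X′ X
SameRoot-sym (Y , Y-root-X , Y-root-X′) = Y , Y-root-X′ , Y-root-X

module _ (V U : List Sym) .{{_ : NonZero (length V)}} .{{_ : NonZero (length U)}} where

  private
    p q : ℕ
    p = length V
    q = length U

  SameRoot⇒pdω≗ : SameRoot (RPD V) (RPD U) → pdω V ≗ pdω U
  SameRoot⇒pdω≗ (Y , ((Y≢[] , _) , l , RPDV≡Y^l) , (_ , k , RPDU≡Y^k)) j = begin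
    pdω V j                         ≡⟨ pdω-cap V q j ⟩
    cap j (pdω V (p + (q * p + j))) ≡⟨ cong (cap j) (RPD≡^⇒pdω≗cycle V Y l RPDV≡Y^l (q * p + j)) ⟩
    cap j (cycle Y (q * p + j))     ≡⟨ cong (λ n → cap j (cycle Y (n + j))) (*-comm q p) ⟩
    cap j (cycle Y (p * q + j))     ≡⟨ cong (cap j) (RPD≡^⇒pdω≗cycle U Y k RPDU≡Y^k (p * q + j)) ⟨
    cap j (pdω U (q + (p * q + j))) ≡⟨ pdω-cap U p j ⟨
    pdω U j                         ∎
    where
    instance
      Y-nonZero : NonZero (length Y)
      Y-nonZero = length-nonZero Y≢[]

  ωpre-<PD⇒FirstDifference : ∀ {n} → PD (ωpre V n) <PD PD (ωpre U n) →
                             ∃ λ j → j < n × FirstDifference _<ₚ_ (pdω V) (pdω U) j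
  ωpre-<PD⇒FirstDifference {n} = Lex-<⇒FirstDifference n ∘ subst₂ _<PD_ (PD-ωpre V n) (PD-ωpre U n)

  FirstDifference⇒ωpre-<PD : ∀ {j n} → j < n → FirstDifference _<ₚ_ (pdω V) (pdω U) j →
                             PD (ωpre V n) <PD PD (ωpre U n)
  FirstDifference⇒ωpre-<PD {n = n} j<n diff =
    subst₂ _<PD_ (sym (PD-ωpre V n)) (sym (PD-ωpre U n)) (FirstDifference⇒Lex-< j<n diff)

  FirstDifference-pdω-< : ∀ {j} → FirstDifference _<ₚ_ (pdω V) (pdω U) j → j < 3 * (p ⊔ q)
  FirstDifference-pdω-< {j} diff@(firstDifference agree _) with j <? 3 * (p ⊔ q)
  ... | yes j<3z = j<3z
  ... | no  j≮3z = ⊥-elim (FirstDifference-irrefl <ₚ-asym pdω≗ diff)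
    where
    pdω≗ : pdω V ≗ pdω U
    pdω≗ = eventually-periodic-≗ (m≤m⊔n p q) (m≤n⊔m p q) (pdω-periodic V) (pdω-periodic U)
             (λ i<3z → agree (<-≤-trans i<3z (≮⇒≥ j≮3z)))

corollary6 : (V U : List Sym) → V ≢ [] → U ≢ [] →
    (V ≺ω U) ⇔ (PD (ωpre V (3 * (length V ⊔ length U))) <PD PD (ωpre U (3 * (length V ⊔ length U))))
corollary6 V U V≢[] U≢[] = mk⇔ to from
  where
  instance
    V-nonZero : NonZero (length V)
    V-nonZero = length-nonZero V≢[]
    U-nonZero : NonZero (length U)
    U-nonZero = length-nonZero U≢[]

  N : ℕ
  N = 3 * (length V ⊔ length U)

  to : V ≺ω U → PD (ωpre V N) <PD PD (ωpre U N)
  to (inj₁ (_ , V<U) , _) with ωpre-<PD⇒FirstDifference V U V<U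
  ... | _ , _ , diff = FirstDifference⇒ωpre-<PD V U (FirstDifference-pdω-< V U diff) diff
  to (inj₂ sameRoot , V≠U) = ⊥-elim (V≠U (inj₂ sameRoot , inj₂ (SameRoot-sym sameRoot)))

  from : PD (ωpre V N) <PD PD (ωpre U N) → V ≺ω U
  from V<U with ωpre-<PD⇒FirstDifference V U V<U
  ... | _ , _ , diff = inj₁ (N , V<U) , λ where
    (_ , inj₁ (_ , U<V)) → let _ , _ , diff′ = ωpre-<PD⇒FirstDifference U V U<V
                           in FirstDifference-asym <ₚ-asym diff diff′
    (_ , inj₂ sameRoot)  → FirstDifference-irrefl <ₚ-asym (SameRoot⇒pdω≗ V U (SameRoot-sym sameRoot)) diff
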